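{- Let $G_n$ be the graph defined below. There is an absolute constant $c>0$ such that $\chi(G_n) \geq c\, n^6$ for all $n\geq 1$, i.e. $\chi(G_n)=\Omega(n^6)$.
   Context: Let $Q_k=\{0,1\}^k$, $0^k$ and $1^k$ the all-zero and all-one vectors, $Q_k^- = Q_k\setminus\{0^k,1^k\}$, and for $X\subset Q_k$, $Y\subset Q_\ell$ let $X\times Y\subset Q_{k+\ell}$ be the set of concatenations $(x,y)$ with $x\in X$, $y\in Y$. Let $S = Q_7 \setminus \big[(1^4\times Q_3^-) \cup \{0^4\times 0^3\}\cup\{0^4\times 1^3\}\big]$. For a positive integer $n$, let $G_n$ be the graph with vertex set $[n]^7$, where for $x,y\in[n]^7$ we define $\rho(x,y)\in Q_7$ by $\rho_i(x,y)=1$ if $x_i\neq y_i$ and $0$ otherwise; $x,y$ are adjacent iff $\rho(x,y)\in S$. $\chi$ denotes chromatic number. -}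

module Defs where

open import Data.Nat using (ℕ; suc; _^_)
open import Data.Fin using (Fin; zero; suc)
open import Data.Fin.Properties using (_≟_)
open import Data.Bool using (Bool; true; false; _∧_; _∨_; not; T)
open import Relation.Nullary using (¬_; does)
open import Relation.Binary.PropositionalEquality using (_≡_)
open import Data.Rational using (ℚ; _≤_; _*_; _/_)
import Data.Integer as ℤ

-- Q_k = {0,1}^k as functions Fin k → Bool (true = 1).
Q : ℕ → Set
Q k = Fin k → Bool

Vertex : ℕ → Set
Vertex n = Fin 7 → Fin n

ρ : ∀ {n} → Vertex n → Vertex n → Q 7
ρ x y i = not (does (x i ≟ y i))

-- Coordinates of a vector in Q_7 = Q_4 × Q_3 (first 4 coordinates, last 3).
firstAllOne : Q 7 → Bool
firstAllOne r = r zero ∧ r (suc zero) ∧ r (suc (suc zero)) ∧ r (suc (suc (suc zero)))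

firstAllZero : Q 7 → Bool
firstAllZero r = not (r zero ∨ r (suc zero) ∨ r (suc (suc zero)) ∨ r (suc (suc (suc zero))))

lastAllOne : Q 7 → Bool
lastAllOne r = r (suc (suc (suc (suc zero)))) ∧ r (suc (suc (suc (suc (suc zero))))) ∧ r (suc (suc (suc (suc (suc (suc zero))))))

lastAllZero : Q 7 → Bool
lastAllZero r = not (r (suc (suc (suc (suc zero)))) ∨ r (suc (suc (suc (suc (suc zero))))) ∨ r (suc (suc (suc (suc (suc (suc zero)))))))

lastInQ3⁻ : Q 7 → Bool
lastInQ3⁻ r = not (lastAllZero r ∨ lastAllOne r)

inS : Q 7 → Bool
inS r = not ((firstAllOne r ∧ lastInQ3⁻ r)
            ∨ (firstAllZero r ∧ lastAllZero r)
            ∨ (firstAllZero r ∧ lastAllOne r))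

Adj : ∀ {n} → Vertex n → Vertex n → Set
Adj x y = T (inS (ρ x y))

ProperColouring : (n k : ℕ) → Set
ProperColouring n k = Σ' (Vertex n → Fin k) λ f → ∀ x y → Adj x y → ¬ (f x ≡ f y)
  where
  open import Data.Product using () renaming (Σ to Σ')

-- χ(G_n) ≥ m  (m rational): every proper colouring with k colours has m ≤ k,
-- i.e. the minimum number of colours of a proper colouring is at least m.
χ≥ : ℕ → ℚ → Set
χ≥ n m = ∀ k → ProperColouring n k → m ≤ (ℤ.+ k) / 1

-- Same-coloured vertices x, y are non-adjacent, so ρ(x,y) ∈ (1⁴ × Q₃⁻) ∪ {0⁷, 0⁴ × 1³}:
-- if their heads (first coordinates) differ they agree somewhere in the last block, and
-- if their heads agree and they agree anywhere in the last block then x = y.  Hence a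
-- colour class containing y, z with distinct heads injects into [n] × [3] via
-- x ↦ (x₀, first place in the last block where x agrees with whichever of y, z has a head
-- different from x₀), while a single-headed class injects into [n] via x ↦ x₄.
-- Every class thus has at most 3n vertices, and χ(G_n) ≥ n⁷/3n = n⁶/3.
module Submission where

open import Defs
open import Data.Nat using (ℕ; _^_) renaming (_≤_ to _≤ℕ_)
open import Data.Product using (Σ; _×_)
open import Data.Rational using (ℚ; _<_; _*_; _/_; 0ℚ)
import Data.Integer as ℤ

open import Data.Bool using (Bool; true; false; T; not)
open import Data.Bool.Properties using (¬-not)
open import Data.Fin using (Fin; zero; suc; _↑ʳ_; combine; finToFun; funToFin)
open import Data.Fin.Properties using (_≟_; any?; combine-injective; funToFin-finToFin; injective⇒≤)
open import Data.Product using (_,_; proj₁; proj₂; ∃; ∃₂; map₁; map₂; uncurry)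
open import Function using (_∘_)
import Data.Integer.Properties as ℤₚ
open import Data.Rational using (_≤_; toℚᵘ; *<*)
open import Data.Rational.Properties using (toℚᵘ-cancel-≤; toℚᵘ-homo-*; toℚᵘ-fromℚᵘ)
open import Data.Rational.Unnormalised as ℚᵘ using (mkℚᵘ)
import Data.Rational.Unnormalised.Properties as ℚᵘ
import Data.Nat as ℕ
import Data.Nat.Properties as ℕₚ
open import Data.Unit using (tt)
open import Data.Vec using (Vec; []; _∷_; lookup; tabulate)
open import Data.Vec.Properties using (lookup∘tabulate; lookup-replicate)
open import Relation.Nullary using (¬_; Dec; yes; no; contradiction)
open import Relation.Nullary.Decidable using (dec-true; dec-false; decidable-stable; _×-dec_; ¬?)
open import Relation.Binary.PropositionalEquality

last : Fin 3 → Fin 7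
last = 4 ↑ʳ_

∉S∧head≡1⇒∃last≡0 : ∀ r → inS r ≡ false → r zero ≡ true → ∃ λ t → r (last t) ≡ false
∉S∧head≡1⇒∃last≡0 r r∉S r₀≡1 =
  map₂ (trans (sym (lookup∘tabulate r (last _)))) (onVec (tabulate r) r∉S r₀≡1)
  where
  onVec : (v : Vec Bool 7) → inS (lookup v) ≡ false → lookup v zero ≡ true →
          ∃ λ t → lookup v (last t) ≡ false
  onVec (false ∷ _) _ ()
  onVec (true ∷ _ ∷ _ ∷ _ ∷ false ∷ _ ∷ _ ∷ []) _ _ = zero , refl
  onVec (true ∷ _ ∷ _ ∷ _ ∷ true ∷ false ∷ _ ∷ []) _ _ = suc zero , refl
  onVec (true ∷ _ ∷ _ ∷ _ ∷ true ∷ true ∷ false ∷ []) _ _ = suc (suc zero) , refl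
  onVec (true ∷ false ∷ _ ∷ _ ∷ true ∷ true ∷ true ∷ []) () _
  onVec (true ∷ true ∷ false ∷ _ ∷ true ∷ true ∷ true ∷ []) () _
  onVec (true ∷ true ∷ true ∷ false ∷ true ∷ true ∷ true ∷ []) () _
  onVec (true ∷ true ∷ true ∷ true ∷ true ∷ true ∷ true ∷ []) () _

-- With equal heads the only non-edges are 0⁷ and 0⁴ × 1³.
∉S∧head≡0∧last≡0⇒≡0 : ∀ r t → inS r ≡ false → r zero ≡ false → r (last t) ≡ false →
                      ∀ i → r i ≡ false
∉S∧head≡0∧last≡0⇒≡0 r t r∉S r₀≡0 rₜ≡0 i =
  trans (sym (lookup∘tabulate r i))
        (onVec (tabulate r) t r∉S r₀≡0 (trans (lookup∘tabulate r (last t)) rₜ≡0) i)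
  where
  onVec : (v : Vec Bool 7) (t : Fin 3) → inS (lookup v) ≡ false → lookup v zero ≡ false →
          lookup v (last t) ≡ false → ∀ i → lookup v i ≡ false
  onVec (true ∷ _) _ _ () _
  onVec (false ∷ true ∷ _) _ () _ _
  onVec (false ∷ false ∷ true ∷ _) _ () _ _
  onVec (false ∷ false ∷ false ∷ true ∷ _) _ () _ _
  onVec (false ∷ false ∷ false ∷ false ∷ false ∷ false ∷ false ∷ []) _ _ _ _ i =
    lookup-replicate i false
  onVec (false ∷ false ∷ false ∷ false ∷ false ∷ true ∷ _ ∷ []) _ () _ _
  onVec (false ∷ false ∷ false ∷ false ∷ false ∷ false ∷ true ∷ []) _ () _ _
  onVec (false ∷ false ∷ false ∷ false ∷ true ∷ false ∷ _ ∷ []) _ () _ _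
  onVec (false ∷ false ∷ false ∷ false ∷ true ∷ true ∷ false ∷ []) _ () _ _
  onVec (false ∷ false ∷ false ∷ false ∷ true ∷ true ∷ true ∷ []) zero _ _ ()
  onVec (false ∷ false ∷ false ∷ false ∷ true ∷ true ∷ true ∷ []) (suc zero) _ _ ()
  onVec (false ∷ false ∷ false ∷ false ∷ true ∷ true ∷ true ∷ []) (suc (suc zero)) _ _ ()

module _ {n : ℕ} {x y : Vertex n} where

  ρ≡false⇒≡ : ∀ {i} → ρ x y i ≡ false → x i ≡ y i
  ρ≡false⇒≡ {i} h with x i ≟ y i
  ... | yes xᵢ≡yᵢ = xᵢ≡yᵢ
  ... | no _ = contradiction h λ ()

  ≡⇒ρ≡false : ∀ {i} → x i ≡ y i → ρ x y i ≡ false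
  ≡⇒ρ≡false {i} xᵢ≡yᵢ = cong not (dec-true (x i ≟ y i) xᵢ≡yᵢ)

  ≢⇒ρ≡true : ∀ {i} → ¬ x i ≡ y i → ρ x y i ≡ true
  ≢⇒ρ≡true {i} xᵢ≢yᵢ = cong not (dec-false (x i ≟ y i) xᵢ≢yᵢ)

  ¬Adj⇒∉S : ¬ Adj x y → inS (ρ x y) ≡ false
  ¬Adj⇒∉S ¬adj = ¬-not λ inS≡true → ¬adj (subst T (sym inS≡true) tt)

  ¬Adj∧heads≢⇒lastBlocksMeet : ¬ Adj x y → ¬ x zero ≡ y zero → ∃ λ t → x (last t) ≡ y (last t)
  ¬Adj∧heads≢⇒lastBlocksMeet ¬adj heads≢ =
    map₂ ρ≡false⇒≡ (∉S∧head≡1⇒∃last≡0 (ρ x y) (¬Adj⇒∉S ¬adj) (≢⇒ρ≡true heads≢))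

  ¬Adj∧heads≡∧last≡⇒≗ : ∀ t → ¬ Adj x y → x zero ≡ y zero → x (last t) ≡ y (last t) → x ≗ y
  ¬Adj∧heads≡∧last≡⇒≗ t ¬adj heads≡ lasts≡ i =
    ρ≡false⇒≡ (∉S∧head≡0∧last≡0⇒≡0 (ρ x y) t (¬Adj⇒∉S ¬adj)
                                     (≡⇒ρ≡false heads≡) (≡⇒ρ≡false lasts≡) i)

funToFin-cong : ∀ {m n} {f g : Fin m → Fin n} → f ≗ g → funToFin f ≡ funToFin g
funToFin-cong {ℕ.zero} _ = refl
funToFin-cong {ℕ.suc m} f≗g = cong₂ combine (f≗g zero) (funToFin-cong (f≗g ∘ suc))

finToFun-injective : ∀ {m n} {i j : Fin (n ^ m)} → finToFun {n} {m} i ≗ finToFun j → i ≡ j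
finToFun-injective {m} {n} {i} {j} i≗j = begin
  i                             ≡⟨ funToFin-finToFin {m} {n} i ⟨
  funToFin (finToFun {n} {m} i) ≡⟨ funToFin-cong i≗j ⟩
  funToFin (finToFun {n} {m} j) ≡⟨ funToFin-finToFin {m} {n} j ⟩
  j                             ∎
  where open ≡-Reasoning

combine²-injective : ∀ {a b c} {p q : (Fin a × Fin b) × Fin c} →
                     uncurry combine (map₁ (uncurry combine) p) ≡
                     uncurry combine (map₁ (uncurry combine) q) → p ≡ q
combine²-injective {p = (i , j) , l} {(i′ , j′) , l′} e with combine-injective _ l _ l′ e
... | ij≡ , refl with combine-injective i j i′ j′ ij≡
... | refl , refl = refl

firstMeet : ∀ {n} (x y : Vertex n) → Fin 3
firstMeet x y with any? (λ t → x (last t) ≟ y (last t))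
... | yes (t , _) = t
... | no _ = zero

firstMeet-meets : ∀ {n} {x y : Vertex n} → ∃ (λ t → x (last t) ≡ y (last t)) →
                  x (last (firstMeet x y)) ≡ y (last (firstMeet x y))
firstMeet-meets {x = x} {y} meet with any? (λ t → x (last t) ≟ y (last t))
... | yes (_ , xₜ≡yₜ) = xₜ≡yₜ
... | no noMeet = contradiction meet noMeet

module ColourClasses {n k : ℕ} (colour : Vertex n → Fin k)
                     (proper : ∀ x y → Adj x y → ¬ colour x ≡ colour y) where

  sameColour⇒¬Adj : ∀ {x y} → colour x ≡ colour y → ¬ Adj x y
  sameColour⇒¬Adj {x} {y} xᶜ≡yᶜ adj = proper x y adj xᶜ≡yᶜ

  partnerOf : (y z : Vertex n) → Fin n → Vertex n
  partnerOf y z a with a ≟ y zero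
  ... | yes _ = z
  ... | no _ = y

  partnerOf-head≢ : ∀ {y z} a → ¬ y zero ≡ z zero → ¬ a ≡ partnerOf y z a zero
  partnerOf-head≢ {y} a y₀≢z₀ with a ≟ y zero
  ... | yes a≡y₀ = λ a≡z₀ → y₀≢z₀ (trans (sym a≡y₀) a≡z₀)
  ... | no a≢y₀ = a≢y₀

  partnerOf-colour : ∀ {y z c} a → colour y ≡ c → colour z ≡ c → colour (partnerOf y z a) ≡ c
  partnerOf-colour {y} a yᶜ zᶜ with a ≟ y zero
  ... | yes _ = zᶜ
  ... | no _ = yᶜ

  twoHeadCode : (y z x : Vertex n) → Fin n × Fin 3
  twoHeadCode y z x = x zero , firstMeet x (partnerOf y z (x zero))

  -- Equal codes give equal heads, hence a common partner w, which x and x′ meet at the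
  -- same place t of the last block.
  twoHeadCode-injective : ∀ {y z x x′ c} → colour y ≡ c → colour z ≡ c → ¬ y zero ≡ z zero →
                          colour x ≡ c → colour x′ ≡ c →
                          twoHeadCode y z x ≡ twoHeadCode y z x′ → x ≗ x′
  twoHeadCode-injective {y} {z} {x} {x′} {c} yᶜ zᶜ y₀≢z₀ xᶜ x′ᶜ codes≡ =
    ¬Adj∧heads≡∧last≡⇒≗ t (sameColour⇒¬Adj (trans xᶜ (sym x′ᶜ))) heads≡ (begin
      x (last t)  ≡⟨ meetsPartner xᶜ x₀≢w₀ ⟩
      w (last t)  ≡⟨ subst (λ s → x′ (last s) ≡ w (last s)) (sym t≡) (meetsPartner x′ᶜ x′₀≢w₀) ⟨
      x′ (last t) ∎)
    where
    open ≡-Reasoning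
    heads≡ : x zero ≡ x′ zero
    heads≡ = cong proj₁ codes≡
    w : Vertex n
    w = partnerOf y z (x zero)
    t : Fin 3
    t = firstMeet x w
    t≡ : t ≡ firstMeet x′ w
    t≡ = subst (λ a → t ≡ firstMeet x′ (partnerOf y z a)) (sym heads≡) (cong proj₂ codes≡)
    x₀≢w₀ : ¬ x zero ≡ w zero
    x₀≢w₀ = partnerOf-head≢ (x zero) y₀≢z₀
    x′₀≢w₀ : ¬ x′ zero ≡ w zero
    x′₀≢w₀ x′₀≡w₀ = x₀≢w₀ (trans heads≡ x′₀≡w₀)
    meetsPartner : ∀ {u} → colour u ≡ c → ¬ u zero ≡ w zero →
                   u (last (firstMeet u w)) ≡ w (last (firstMeet u w))
    meetsPartner {u} uᶜ u₀≢w₀ = firstMeet-meets {x = u} {w}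
      (¬Adj∧heads≢⇒lastBlocksMeet {x = u} {w}
        (sameColour⇒¬Adj (trans uᶜ (sym (partnerOf-colour (x zero) yᶜ zᶜ)))) u₀≢w₀)

  vertex : Fin (n ^ 7) → Vertex n
  vertex = finToFun

  MultiHeaded : Fin k → Set
  MultiHeaded c = ∃₂ λ i j → colour (vertex i) ≡ c × colour (vertex j) ≡ c ×
                             ¬ vertex i zero ≡ vertex j zero

  multiHeaded? : ∀ c → Dec (MultiHeaded c)
  multiHeaded? c = any? λ i → any? λ j →
    (colour (vertex i) ≟ c) ×-dec (colour (vertex j) ≟ c) ×-dec ¬? (vertex i zero ≟ vertex j zero)

  classCode : ∀ c → Dec (MultiHeaded c) → Fin (n ^ 7) → Fin n × Fin 3
  classCode c (yes (i , j , _)) l = twoHeadCode (vertex i) (vertex j) (vertex l)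
  classCode c (no _) l = vertex l (last zero) , zero

  classCode-injective : ∀ c (d : Dec (MultiHeaded c)) {l l′} →
                        colour (vertex l) ≡ c → colour (vertex l′) ≡ c →
                        classCode c d l ≡ classCode c d l′ → vertex l ≗ vertex l′
  classCode-injective c (yes (i , j , iᶜ , jᶜ , heads≢)) lᶜ l′ᶜ =
    twoHeadCode-injective iᶜ jᶜ heads≢ lᶜ l′ᶜ
  classCode-injective c (no oneHead) {l} {l′} lᶜ l′ᶜ codes≡ =
    ¬Adj∧heads≡∧last≡⇒≗ zero (sameColour⇒¬Adj (trans lᶜ (sym l′ᶜ))) heads≡ (cong proj₁ codes≡)
    where
    heads≡ : vertex l zero ≡ vertex l′ zero
    heads≡ = decidable-stable (vertex l zero ≟ vertex l′ zero)
                              λ heads≢ → oneHead (l , l′ , lᶜ , l′ᶜ , heads≢)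

  code : Fin (n ^ 7) → (Fin n × Fin 3) × Fin k
  code l = classCode (colour (vertex l)) (multiHeaded? _) l , colour (vertex l)

  code-injective : ∀ {l l′} → code l ≡ code l′ → l ≡ l′
  code-injective {l} {l′} codes≡ =
    finToFun-injective (classCode-injective c (multiHeaded? c) refl (sym colours≡) classCodes≡)
    where
    c : Fin k
    c = colour (vertex l)
    colours≡ : c ≡ colour (vertex l′)
    colours≡ = cong proj₂ codes≡
    classCodes≡ : classCode c (multiHeaded? c) l ≡ classCode c (multiHeaded? c) l′
    classCodes≡ = trans (cong proj₁ codes≡)
                        (cong (λ c′ → classCode c′ (multiHeaded? c′) l′) (sym colours≡))

  n⁷≤n*3*k : n ^ 7 ≤ℕ n ℕ.* 3 ℕ.* k
  n⁷≤n*3*k = injective⇒≤ {f = uncurry combine ∘ map₁ (uncurry combine) ∘ code}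
                         (code-injective ∘ combine²-injective)

n⁶≤3*k : ∀ {n k} → 1 ≤ℕ n → ProperColouring n k → n ^ 6 ≤ℕ 3 ℕ.* k
n⁶≤3*k {n} {k} 1≤n (colour , proper) =
  ℕₚ.*-cancelˡ-≤ n {{ℕ.>-nonZero 1≤n}} (subst (n ^ 7 ≤ℕ_) (ℕₚ.*-assoc n 3 k) (n⁷≤n*3*k))
  where open ColourClasses colour proper

third : ℚ
third = ℤ.+ 1 / 3

third-positive : 0ℚ < third
third-positive = *<* (ℤ.+<+ (ℕ.s≤s ℕ.z≤n))

third*m≤k : ∀ {m k} → m ≤ℕ 3 ℕ.* k → third * (ℤ.+ m / 1) ≤ ℤ.+ k / 1
third*m≤k {m} {k} m≤3k = toℚᵘ-cancel-≤ (begin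
  toℚᵘ (third * (ℤ.+ m / 1))             ≃⟨ toℚᵘ-homo-* third (ℤ.+ m / 1) ⟩
  toℚᵘ third ℚᵘ.* toℚᵘ (ℤ.+ m / 1)       ≃⟨ ℚᵘ.*-congˡ {toℚᵘ third} (toℚᵘ-fromℚᵘ (mkℚᵘ (ℤ.+ m) 0)) ⟩
  toℚᵘ third ℚᵘ.* mkℚᵘ (ℤ.+ m) 0         ≤⟨ ℚᵘ.*≤* numerators≤ ⟩
  mkℚᵘ (ℤ.+ k) 0                         ≃⟨ toℚᵘ-fromℚᵘ (mkℚᵘ (ℤ.+ k) 0) ⟨
  toℚᵘ (ℤ.+ k / 1)                       ∎)
  where
  open ℚᵘ.≤-Reasoning
  numerators≤ : (ℤ.+ 1 ℤ.* ℤ.+ m) ℤ.* ℤ.+ 1 ℤ.≤ ℤ.+ k ℤ.* ℤ.+ 3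
  numerators≤ = subst₂ ℤ._≤_ (sym (trans (ℤₚ.*-identityʳ _) (ℤₚ.*-identityˡ _)))
                             (trans (ℤₚ.pos-* 3 k) (ℤₚ.*-comm (ℤ.+ 3) (ℤ.+ k))) (ℤ.+≤+ m≤3k)

corollary2p2 : Σ ℚ λ c → (0ℚ < c) × (∀ (n : ℕ) → 1 ≤ℕ n → χ≥ n (c * ((ℤ.+ (n ^ 6)) / 1)))
corollary2p2 = third , third-positive , λ n 1≤n k colouring → third*m≤k {k = k} (n⁶≤3*k 1≤n colouring)
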